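{- Let $\mathcal L$ be a pre-reversible combined LTSI satisfying IRE or IEC. Then $\mathcal L$ satisfies Event Coherence: whenever $t\sim t'$, it is not the case that $t\,\iota\,t'$.
   Context: Setting. $\mathrm{Lab}$ is a set of labels and $\overline{\mathrm{Lab}}=\{\overline a: a\in\mathrm{Lab}\}$ a disjoint copy (reverse labels), with $\overline{\overline a}=a$. A combined LTSI $(\mathrm{Proc},\mathrm{Lab},\to,\iota)$ consists of a set $\mathrm{Proc}$ of processes, a set of forward transitions $(P,a,Q)$ with $a\in\mathrm{Lab}$, the set $\to$ of all transitions, consisting of the forward transitions together with, for each forward transition $(P,a,Q)$, the backward transition $(Q,\overline a,P)$, and an irreflexive symmetric relation $\iota$ on transitions. Write $t:P\xrightarrow{\alpha}Q$ for $t=(P,\alpha,Q)$ and $\overline t=(Q,\overline\alpha,P)$. Transitions are coinitial if they have the same source. Axioms. SP: whenever $t:P\xrightarrow{\alpha}Q$, $u:P\xrightarrow{\beta}R$, $t\,\iota\,u$, there are $u':Q\xrightarrow{\beta}S$, $t':R\xrightarrow{\alpha}S$. BTI: distinct backward transitions with the same source are independent. WF: no infinite sequence $P_0,P_1,\dots$ with forward transitions $P_{i+1}\xrightarrow{a_i}P_i$ for all $i$. PCI: if $t:P\xrightarrow{\alpha}Q$, $u:P\xrightarrow{\beta}R$, $u':Q\xrightarrow{\beta}S$, $t':R\xrightarrow{\alpha}S$ and $t\,\iota\,u$, then $u'\,\iota\,\overline t$. Pre-reversible means SP, BTI, WF and PCI hold. Events: $\sim$ is the smallest equivalence relation on transitions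 such that whenever $t:P\xrightarrow{\alpha}Q$, $u:P\xrightarrow{\beta}R$, $u':Q\xrightarrow{\beta}S$, $t':R\xrightarrow{\alpha}S$ with $t\,\iota\,u$, $\overline u\,\iota\,t'$, $\overline{t'}\,\iota\,\overline{u'}$, $u'\,\iota\,\overline t$, and with $Q\ne R$ if $\alpha,\beta$ are both forward or both reverse labels and $P\ne S$ otherwise, then $t\sim t'$. Events are classes $[t]$. $e\,\iota_c\,e'$ iff there are coinitial transitions $t,t'$ with $[t]=e$, $[t']=e'$, $t\,\iota\,t'$. IRE: whenever $t\sim t'$ and $t'\,\iota\,u$, then $t\,\iota\,u$. IEC: whenever $t_1\,\iota\,t_2$, then $[t_1]\,\iota_c\,[t_2]$. -}

module Defs where

open import Data.Nat using (ℕ; suc)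
open import Data.Product using (Σ; ∃; _×_; _,_)
open import Data.Sum using (_⊎_; inj₁; inj₂)
open import Data.Empty using (⊥)
open import Relation.Nullary using (¬_)
open import Relation.Binary.PropositionalEquality using (_≡_; _≢_)

-- Labels of a combined LTSI: inj₁ a is the forward label a, inj₂ a is the reverse label ā.
Lbl : Set → Set
Lbl Lab = Lab ⊎ Lab

rev : {Lab : Set} → Lbl Lab → Lbl Lab
rev (inj₁ a) = inj₂ a
rev (inj₂ a) = inj₁ a

-- Triples (P , α , Q); whether a triple is a transition is a predicate.
Tr : Set → Set → Set
Tr Proc Lab = Proc × Lbl Lab × Proc

src : {Proc Lab : Set} → Tr Proc Lab → Proc
src (P , _ , _) = P

bar : {Proc Lab : Set} → Tr Proc Lab → Tr Proc Lab
bar (P , α , Q) = (Q , rev α , P)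

SameDir : {Lab : Set} → Lbl Lab → Lbl Lab → Set
SameDir (inj₁ _) (inj₁ _) = Data.Unit.⊤ where import Data.Unit
SameDir (inj₂ _) (inj₂ _) = Data.Unit.⊤ where import Data.Unit
SameDir _ _ = ⊥

-- the set → of all transitions: forward ones plus their reverses
IsTransOf : {Proc Lab : Set} → (Proc → Lab → Proc → Set) → Tr Proc Lab → Set
IsTransOf Fwd (P , inj₁ a , Q) = Fwd P a Q
IsTransOf Fwd (P , inj₂ a , Q) = Fwd Q a P

record LTSI : Set₁ where
  field
    Proc : Set
    Lab  : Set
    Fwd  : Proc → Lab → Proc → Set
    ι    : Tr Proc Lab → Tr Proc Lab → Set

    ι-onTrans : ∀ t u → ι t u → IsTransOf Fwd t × IsTransOf Fwd u
    ι-irrefl  : ∀ t → ¬ ι t t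
    ι-sym     : ∀ t u → ι t u → ι u t

module _ (L : LTSI) where
  open LTSI L

  IsTrans : Tr Proc Lab → Set
  IsTrans = IsTransOf Fwd

  SP : Set
  SP = ∀ P α Q β R → IsTrans (P , α , Q) → IsTrans (P , β , R)
     → ι (P , α , Q) (P , β , R)
     → Σ Proc λ S → IsTrans (Q , β , S) × IsTrans (R , α , S)

  BTI : Set
  BTI = ∀ P a Q b R → IsTrans (P , inj₂ a , Q) → IsTrans (P , inj₂ b , R)
      → _≢_ {A = Tr Proc Lab} (P , inj₂ a , Q) (P , inj₂ b , R)
      → ι (P , inj₂ a , Q) (P , inj₂ b , R)

  WF : Set
  WF = ¬ (Σ (ℕ → Proc) λ P → Σ (ℕ → Lab) λ a → ∀ i → Fwd (P (suc i)) (a i) (P i))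

  PCI : Set
  PCI = ∀ P α Q β R S
      → IsTrans (P , α , Q) → IsTrans (P , β , R)
      → IsTrans (Q , β , S) → IsTrans (R , α , S)
      → ι (P , α , Q) (P , β , R)
      → ι (Q , β , S) (bar (P , α , Q))

  record PreReversible : Set where
    field
      sp  : SP
      bti : BTI
      wf  : WF
      pci : PCI

  SquareNondeg : Proc → Lbl Lab → Proc → Lbl Lab → Proc → Proc → Set
  SquareNondeg P α Q β R S = (SameDir α β → Q ≢ R) × (¬ SameDir α β → P ≢ S)

  data _∼_ : Tr Proc Lab → Tr Proc Lab → Set where
    ∼-refl  : ∀ t → IsTrans t → t ∼ t
    ∼-sym   : ∀ {t t'} → t ∼ t' → t' ∼ t
    ∼-trans : ∀ {t t' t''} → t ∼ t' → t' ∼ t'' → t ∼ t''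
    ∼-sq    : ∀ P α Q β R S
            → IsTrans (P , α , Q) → IsTrans (P , β , R)
            → IsTrans (Q , β , S) → IsTrans (R , α , S)
            → ι (P , α , Q) (P , β , R)
            → ι (bar (P , β , R)) (R , α , S)
            → ι (bar (R , α , S)) (bar (Q , β , S))
            → ι (Q , β , S) (bar (P , α , Q))
            → SquareNondeg P α Q β R S
            → (P , α , Q) ∼ (R , α , S)

  _ιc_ : Tr Proc Lab → Tr Proc Lab → Set
  t₁ ιc t₂ = Σ (Tr Proc Lab) λ t → Σ (Tr Proc Lab) λ t' →
             src t ≡ src t' × t ∼ t₁ × t' ∼ t₂ × ι t t'

  IRE : Set
  IRE = ∀ t t' u → t ∼ t' → ι t' u → ι t u

  IEC : Set
  IEC = ∀ t₁ t₂ → ι t₁ t₂ → t₁ ιc t₂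

  EventCoherence : Set
  EventCoherence = ∀ t t' → t ∼ t' → ¬ ι t t'

-- Transitions in the same event carry the same label. Under IRE, t ∼ t' and t ι t'
-- give t' ι t', contradicting irreflexivity. Under IEC, t ι t' yields coinitial
-- independent transitions s, s' with s ∼ t and s' ∼ t', hence with equal labels.
-- That is impossible: SP closes s, s' into a square, and PCI turns it into an
-- independence between a transition and the reverse of a coinitial transition with
-- the same label; a second application of PCI, to the degenerate square that goes
-- forward and back, makes some transition independent of itself.
module Submission where

open import Defs
open import Data.Sum using (_⊎_; inj₁; inj₂)
open import Data.Product using (_,_; proj₁; proj₂)
open import Relation.Nullary using (¬_)
open import Relation.Binary.PropositionalEquality using (_≡_; refl; sym; trans)

module _ (L : LTSI) where
  open LTSI L

  label : Tr Proc Lab → Lbl Lab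
  label (_ , α , _) = α

  ∼⇒≡label : ∀ {t t'} → _∼_ L t t' → label t ≡ label t'
  ∼⇒≡label (∼-refl _ _)                     = refl
  ∼⇒≡label (∼-sym p)                        = sym (∼⇒≡label p)
  ∼⇒≡label (∼-trans p q)                    = trans (∼⇒≡label p) (∼⇒≡label q)
  ∼⇒≡label (∼-sq _ _ _ _ _ _ _ _ _ _ _ _ _ _ _) = refl

  module _ (pci : PCI L) where

    ¬ι-forward-reverse : ∀ P a Q R → ¬ ι (P , inj₁ a , Q) (P , inj₂ a , R)
    ¬ι-forward-reverse P a Q R i =
      let t , u = ι-onTrans _ _ i
      in ι-irrefl _ (pci P (inj₁ a) Q (inj₂ a) R P t u t u i)

    ¬ι-opposite-labels : ∀ P α Q R → ¬ ι (P , α , Q) (P , rev α , R)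
    ¬ι-opposite-labels P (inj₁ a) Q R i = ¬ι-forward-reverse P a Q R i
    ¬ι-opposite-labels P (inj₂ a) Q R i = ¬ι-forward-reverse P a R Q (ι-sym _ _ i)

    ¬ι-same-label : SP L → ∀ P α Q R → ¬ ι (P , α , Q) (P , α , R)
    ¬ι-same-label sp P α Q R i =
      let t , u       = ι-onTrans _ _ i
          S , u' , t' = sp P α Q α R t u i
      in ¬ι-opposite-labels Q α S P (pci P α Q α R S t u u' t' i)

    ¬ι-coinitial-equal-labels : SP L → ∀ s s' → src s ≡ src s' → label s ≡ label s' → ¬ ι s s'
    ¬ι-coinitial-equal-labels sp (P , α , Q) (.P , .α , R) refl refl =
      ¬ι-same-label sp P α Q R

  IRE⇒EventCoherence : IRE L → EventCoherence L
  IRE⇒EventCoherence ire t t' t∼t' i = ι-irrefl t' (ire t' t t' (∼-sym t∼t') i)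

  IEC⇒EventCoherence : SP L → PCI L → IEC L → EventCoherence L
  IEC⇒EventCoherence sp pci iec t t' t∼t' i with iec t t' i
  ... | s , s' , coinitial , s∼t , s'∼t' , j =
    ¬ι-coinitial-equal-labels pci sp s s' coinitial same-label j
    where
      same-label : label s ≡ label s'
      same-label = trans (∼⇒≡label s∼t) (trans (∼⇒≡label t∼t') (sym (∼⇒≡label s'∼t')))

proposition5p14 : (L : LTSI) → PreReversible L → IRE L ⊎ IEC L → EventCoherence L
proposition5p14 L pr (inj₁ ire) = IRE⇒EventCoherence L ire
proposition5p14 L pr (inj₂ iec) = IEC⇒EventCoherence L sp pci iec
  where open PreReversible pr
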